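{- Let $\mathfrak{m}=(\pi,S)$ be a marked perfect matching with respect to $(n_1,\dots,n_k)$ having at least one homogeneous edge. Suppose the set $\{j: e_j \text{ homogeneous},\ \mathrm{bdiff}_{\mathfrak{m}}(e_j)<0\}$ is nonempty, let $i$ be its minimum, and suppose $e_i$ is not convertible in $\mathfrak{m}$. Then the set \[\{j<i:\ e_j \text{ homogeneous},\ \mathrm{bdiff}_{\mathfrak{m}}(e_j)=0,\ e_j \text{ crosses } e_i\}\] is nonempty.
   Context: Fix positive integers $n_1,\dots,n_k$ and $N=n_1+\dots+n_k$. Let $\pi$ be a permutation of $[N]$, viewed as a perfect matching with edges $e_i=(i,\overline{\pi(i)})$. An edge $e_i$ is homogeneous if $n_1+\dots+n_{r-1}+1\le i,\pi(i)\le n_1+\dots+n_r$ for some $r\in[k]$, inhomogeneous otherwise. A marked perfect matching is a pair $\mathfrak{m}=(\pi,S)$ with $S$ a set of edges of $\pi$ containing all inhomogeneous edges (edges in $S$ are marked). $\mathrm{bind}^U_{\mathfrak{m}}(i)$ is $1$ plus the number of $u<i$ with $e_u\in S$; $\mathrm{bind}^L_{\mathfrak{m}}(j)$ is $1$ plus the number of $v<j$ such that the edge with lower endpoint $\bar v$ is in $S$; $\mathrm{bdiff}_{\mathfrak{m}}(e_i)=\mathrm{bind}^L_{\mathfrak{m}}(\pi(i))-\mathrm{bind}^U_{\mathfrak{m}}(i)$. Two edges $e_a,e_b$ cross if $(a-b)(\pi(a)-\pi(b))<0$; $e_j$ crosses $e_i$ from the left (equivalently $e_i$ crosses $e_j$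 from the right) if $j<i$ and $\pi(j)>\pi(i)$. A homogeneous edge $e$ is convertible in $\mathfrak{m}$ if: when $e\notin S$, every edge $e'$ crossing $e$ either crosses $e$ from the left with $\mathrm{bdiff}_{\mathfrak{m}}(e')\ge0$ or crosses $e$ from the right with $\mathrm{bdiff}_{\mathfrak{m}}(e')\le-1$; when $e\in S$, every edge $e'$ crossing $e$ either crosses $e$ from the left with $\mathrm{bdiff}_{\mathfrak{m}}(e')>0$ or crosses $e$ from the right with $\mathrm{bdiff}_{\mathfrak{m}}(e')<-1$. -}

module Defs where

open import Data.Nat using (ℕ; zero; suc; _+_; _<ᵇ_; _∸_) renaming (_<_ to _<ℕ_)
open import Data.List using (List; []; _∷_)
open import Data.Nat.ListAction using (sum)
open import Data.Bool using (Bool; true; false; if_then_else_; _∧_)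
open import Data.Fin using (Fin; toℕ) renaming (zero to fzero; suc to fsuc)
open import Data.Fin.Permutation using (Permutation′; _⟨$⟩ʳ_; _⟨$⟩ˡ_)
open import Data.Integer as ℤ using (ℤ; +_; _-_; _*_)
open import Data.Product using (_×_)
open import Data.Sum using (_⊎_)
open import Relation.Binary.PropositionalEquality using (_≡_)
open import Relation.Nullary using (¬_)

-- Positions 1..N of the paper are represented 0-indexed by Fin N.
-- blockOf ns x = (r - 1) where x (0-indexed) lies in the r-th block of sizes ns.
blockOf : List ℕ → ℕ → ℕ
blockOf []       x = 0
blockOf (n ∷ ns) x = if x <ᵇ n then 0 else suc (blockOf ns (x ∸ n))

count : ∀ {N} → (Fin N → Bool) → ℕ
count {zero}  p = 0
count {suc N} p = (if p fzero then 1 else 0) + count (λ u → p (fsuc u))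

-- A marked perfect matching w.r.t. ns: permutation π of [N], N = sum ns,
-- and a marking S (S i = true iff the edge e_i = (i, π(i)‾) is marked).
module _ (ns : List ℕ) (π : Permutation′ (sum ns)) where

  N : ℕ
  N = sum ns

  Homogeneous : Fin N → Set
  Homogeneous i = blockOf ns (toℕ i) ≡ blockOf ns (toℕ (π ⟨$⟩ʳ i))

  IsMarking : (Fin N → Bool) → Set
  IsMarking S = ∀ i → ¬ Homogeneous i → S i ≡ true

  Crosses : Fin N → Fin N → Set
  Crosses a b = ((+ toℕ a) - (+ toℕ b)) * ((+ toℕ (π ⟨$⟩ʳ a)) - (+ toℕ (π ⟨$⟩ʳ b))) ℤ.< + 0

  CrossesFromLeft : Fin N → Fin N → Set
  CrossesFromLeft j i = (toℕ j <ℕ toℕ i) × (toℕ (π ⟨$⟩ʳ i) <ℕ toℕ (π ⟨$⟩ʳ j))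

  CrossesFromRight : Fin N → Fin N → Set
  CrossesFromRight j i = CrossesFromLeft i j

  module _ (S : Fin N → Bool) where

    bindU : Fin N → ℕ
    bindU i = suc (count (λ u → (toℕ u <ᵇ toℕ i) ∧ S u))

    -- the edge with lower endpoint v‾ is e_{π⁻¹(v)}
    bindL : Fin N → ℕ
    bindL j = suc (count (λ v → (toℕ v <ᵇ toℕ j) ∧ S (π ⟨$⟩ˡ v)))

    bdiff : Fin N → ℤ
    bdiff i = (+ bindL (π ⟨$⟩ʳ i)) - (+ bindU i)

    ConvCond : Bool → Fin N → Set
    ConvCond false e = ∀ e' → Crosses e' e →
        (CrossesFromLeft e' e × (+ 0) ℤ.≤ bdiff e')
      ⊎ (CrossesFromRight e' e × bdiff e' ℤ.≤ ℤ.-[1+ 0 ])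
    ConvCond true e = ∀ e' → Crosses e' e →
        (CrossesFromLeft e' e × (+ 0) ℤ.< bdiff e')
      ⊎ (CrossesFromRight e' e × bdiff e' ℤ.< ℤ.-[1+ 0 ])

    Convertible : Fin N → Set
    Convertible e = Homogeneous e × ConvCond (S e) e

-- Write bdiff e = L(e) − U(e), where U(e) counts the marked edges whose upper endpoint lies
-- left of that of e and L(e) those whose lower endpoint lies left of that of e. If no
-- homogeneous edge of bdiff 0 crosses e_i from the left, then e_i is convertible: an edge
-- crossing from the right has L ≤ L(e_i) and U ≥ U(e_i) + [e_i marked], so its bdiff is at
-- most bdiff e_i − [e_i marked]; a homogeneous edge crossing from the left has bdiff ≥ 0 by
-- the minimality of i, and ≠ 0 by assumption; an inhomogeneous edge e crossing from the left
-- runs from its block into a later block r, and since unmarked edges stay inside their block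
-- and π is a bijection, as many marked edges start in the blocks before r as end there,
-- which gives U(e) + 1 ≤ L(e).

module Submission where

open import Defs
open import Data.Nat using (ℕ; _<_; _≤_)
open import Data.List using (List)
open import Data.Nat.ListAction using (sum)
open import Data.List.Relation.Unary.All using (All)
open import Data.Bool using (Bool)
open import Data.Fin using (Fin; toℕ)
open import Data.Fin.Permutation using (Permutation′)
open import Data.Integer as ℤ using (ℤ; +_)
open import Data.Product using (_×_; ∃)
open import Relation.Binary.PropositionalEquality using (_≡_)
open import Relation.Nullary using (¬_)

open import Data.Nat using (zero; suc; _+_; z≤n; s≤s; _<ᵇ_)
open import Data.Nat.Properties
  using (≤-refl; ≤-trans; <-trans; ≤-<-trans; <-≤-trans; <⇒≤; <⇒≱; ≰⇒>; ≤∧≢⇒<; n<1+n; <-irrefl;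
         +-mono-≤; +-mono-≤-<; +-cancelʳ-≡; <ᵇ⇒<; <⇒<ᵇ; <ᵇ-reflects-<; ≮⇒≥; ∸-monoˡ-≤; +-0-commutativeMonoid; _<?_; module ≤-Reasoning)
  renaming (_≟_ to _≟ℕ_)
open import Data.Bool using (true; false; T; not; _∧_; if_then_else_)
open import Data.Bool.Properties using (T-∧; T-≡; ∧-zeroʳ)
open import Data.Unit using (tt)
open import Data.Empty using (⊥-elim)
open import Data.Fin using () renaming (zero to fzero; suc to fsuc)
open import Data.Fin.Properties using (any?)
open import Data.Fin.Permutation using (_⟨$⟩ʳ_; _⟨$⟩ˡ_; inverseˡ)
open import Data.Integer using (+[1+_]; -[1+_]; _⊖_)
open import Data.Integer.Properties as ℤ
  using (n⊖n≡0; [1+m]⊖[1+n]≡m⊖n; [+m]-[+n]≡m⊖n; ⊖-monoˡ-≤; ⊖-monoˡ-<; ⊖-monoʳ->-<;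
         i<j⇒i≤pred[j]; pos-*; *-zeroʳ)
open import Data.List using ([]; _∷_)
open import Data.Product using (_,_; proj₁; map₁)
open import Data.Sum using (_⊎_; inj₁; inj₂)
open import Function using (_∘_; Equivalence)
open import Relation.Binary.PropositionalEquality using (_≢_; refl; sym; trans; cong; cong₂; subst; module ≡-Reasoning)
open import Relation.Nullary using (Dec; yes; no; contradiction)
open import Relation.Nullary.Reflects using (ofʸ; ofⁿ)
open import Relation.Nullary.Decidable using (_×-dec_; decidable-stable)
open import Algebra.Properties.CommutativeMonoid.Sum +-0-commutativeMonoid
  using (sum-cong-≗; ∑-distrib-+; sum-permute)
  renaming (sum to ∑)

open Equivalence using (to; from)

private
  variable
    n m : ℕ
    a b : Bool

indicator : Bool → ℕ
indicator b = if b then 1 else 0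

indicator-mono : (T a → T b) → indicator a ≤ indicator b
indicator-mono {false}         _    = z≤n
indicator-mono {true}  {true}  _    = ≤-refl
indicator-mono {true}  {false} a⇒b = ⊥-elim (a⇒b tt)

indicator-split : ∀ a b → indicator a ≡ indicator (a ∧ b) + indicator (a ∧ not b)
indicator-split false _     = refl
indicator-split true  false = refl
indicator-split true  true  = refl

count≡∑ : (p : Fin n → Bool) → count p ≡ ∑ (indicator ∘ p)
count≡∑ {zero}  p = refl
count≡∑ {suc n} p = cong (λ c → indicator (p fzero) + c) (count≡∑ (p ∘ fsuc))

count-cong : {p q : Fin n → Bool} → (∀ u → p u ≡ q u) → count p ≡ count q
count-cong {p = p} {q} p≗q = begin
  count p             ≡⟨ count≡∑ p ⟩
  ∑ (indicator ∘ p)   ≡⟨ sum-cong-≗ (cong indicator ∘ p≗q) ⟩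
  ∑ (indicator ∘ q)   ≡⟨ count≡∑ q ⟨
  count q             ∎
  where open ≡-Reasoning

count-split : (p q : Fin n → Bool) → count p ≡ count (λ u → p u ∧ q u) + count (λ u → p u ∧ not (q u))
count-split p q = begin
  count p                                                           ≡⟨ count≡∑ p ⟩
  ∑ (indicator ∘ p)                                                 ≡⟨ sum-cong-≗ (λ u → indicator-split (p u) (q u)) ⟩
  ∑ (λ u → indicator (p u ∧ q u) + indicator (p u ∧ not (q u)))     ≡⟨ ∑-distrib-+ (λ u → indicator (p u ∧ q u)) (λ u → indicator (p u ∧ not (q u))) ⟩
  ∑ (λ u → indicator (p u ∧ q u)) + ∑ (λ u → indicator (p u ∧ not (q u)))
    ≡⟨ cong₂ _+_ (count≡∑ (λ u → p u ∧ q u)) (count≡∑ (λ u → p u ∧ not (q u))) ⟨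
  count (λ u → p u ∧ q u) + count (λ u → p u ∧ not (q u))           ∎
  where open ≡-Reasoning

count-permute : (σ : Permutation′ n) (p : Fin n → Bool) → count p ≡ count (p ∘ (σ ⟨$⟩ʳ_))
count-permute σ p = begin
  count p                           ≡⟨ count≡∑ p ⟩
  ∑ (indicator ∘ p)                 ≡⟨ sum-permute (indicator ∘ p) σ ⟩
  ∑ (indicator ∘ p ∘ (σ ⟨$⟩ʳ_))     ≡⟨ count≡∑ (p ∘ (σ ⟨$⟩ʳ_)) ⟨
  count (p ∘ (σ ⟨$⟩ʳ_))             ∎
  where open ≡-Reasoning

count-mono : {p q : Fin n → Bool} → (∀ u → T (p u) → T (q u)) → count p ≤ count q
count-mono {zero}  _   = z≤n
count-mono {suc n} p⇒q = +-mono-≤ (indicator-mono (p⇒q fzero)) (count-mono (p⇒q ∘ fsuc))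

count-mono-< : {p q : Fin n → Bool} → (∀ u → T (p u) → T (q u)) →
               ∀ k → ¬ T (p k) → T (q k) → count p < count q
count-mono-< {p = p} {q} p⇒q fzero ¬pk qk with p fzero | q fzero
... | false | true  = s≤s (count-mono (p⇒q ∘ fsuc))
... | true  | _     = ⊥-elim (¬pk tt)
... | false | false = ⊥-elim qk
count-mono-< p⇒q (fsuc k) ¬pk qk =
  +-mono-≤-< (indicator-mono (p⇒q fzero)) (count-mono-< (p⇒q ∘ fsuc) k ¬pk qk)

m⊖n<0⇒m<n : m ⊖ n ℤ.< + 0 → m < n
m⊖n<0⇒m<n {m} {n} m⊖n<0 = ≰⇒> λ n≤m →
  ℤ.<⇒≱ m⊖n<0 (subst (ℤ._≤ m ⊖ n) (n⊖n≡0 n) (⊖-monoˡ-≤ n n≤m))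

0<m⊖n⇒n<m : + 0 ℤ.< m ⊖ n → n < m
0<m⊖n⇒n<m {m} {n} 0<m⊖n = ≰⇒> λ m≤n →
  ℤ.<⇒≱ 0<m⊖n (subst (m ⊖ n ℤ.≤_) (n⊖n≡0 n) (⊖-monoˡ-≤ n m≤n))

n<m⇒0<m⊖n : n < m → + 0 ℤ.< m ⊖ n
n<m⇒0<m⊖n {n} {m} n<m = subst (ℤ._< m ⊖ n) (n⊖n≡0 n) (⊖-monoˡ-< n n<m)

m<n⇒m⊖n≤-1 : m < n → m ⊖ n ℤ.≤ -[1+ 0 ]
m<n⇒m⊖n≤-1 {m} {n} m<n = i<j⇒i≤pred[j] (subst (m ⊖ n ℤ.<_) (n⊖n≡0 m) (⊖-monoʳ->-< m m<n))

1+m<n⇒m⊖n<-1 : suc m < n → m ⊖ n ℤ.< -[1+ 0 ]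
1+m<n⇒m⊖n<-1 {m} 1+m<n = ℤ.<-≤-trans (⊖-monoʳ->-< m 1+m<n) (m<n⇒m⊖n≤-1 (n<1+n m))

i*j<0⇒[i<0×0<j]⊎[0<i×j<0] : ∀ i j → i ℤ.* j ℤ.< + 0 →
  (i ℤ.< + 0 × + 0 ℤ.< j) ⊎ (+ 0 ℤ.< i × j ℤ.< + 0)
i*j<0⇒[i<0×0<j]⊎[0<i×j<0] (+ m)      (+ n)      ij<0 =
  ⊥-elim (ℤ.<⇒≱ (subst (ℤ._< + 0) (sym (pos-* m n)) ij<0) (ℤ.+≤+ z≤n))
i*j<0⇒[i<0×0<j]⊎[0<i×j<0] (+ 0)      -[1+ n ]   (ℤ.+<+ ())
i*j<0⇒[i<0×0<j]⊎[0<i×j<0] +[1+ m ]   -[1+ n ]   _    = inj₂ (ℤ.+<+ (s≤s z≤n) , ℤ.-<+)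
i*j<0⇒[i<0×0<j]⊎[0<i×j<0] -[1+ m ]   +[1+ n ]   _    = inj₁ (ℤ.-<+ , ℤ.+<+ (s≤s z≤n))
i*j<0⇒[i<0×0<j]⊎[0<i×j<0] -[1+ m ]   (+ 0)      ij<0 = ⊥-elim (ℤ.<-irrefl (*-zeroʳ -[1+ m ]) ij<0)
i*j<0⇒[i<0×0<j]⊎[0<i×j<0] -[1+ m ]   -[1+ n ]   (ℤ.+<+ ())

blockOf-mono : ∀ ns {x y} → x ≤ y → blockOf ns x ≤ blockOf ns y
blockOf-mono []       _   = z≤n
blockOf-mono (n ∷ ns) {x} {y} x≤y
  with x <ᵇ n | <ᵇ-reflects-< x n | y <ᵇ n | <ᵇ-reflects-< y n
... | true  | _        | _     | _       = z≤n
... | false | ofⁿ x≮n | true  | ofʸ y<n = contradiction (≤-trans (≮⇒≥ x≮n) x≤y) (<⇒≱ y<n)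
... | false | _        | false | _       = s≤s (blockOf-mono ns (∸-monoˡ-≤ n x≤y))

blockOf-cancel-< : ∀ ns {x y} → blockOf ns x < blockOf ns y → x < y
blockOf-cancel-< ns bx<by = ≰⇒> λ y≤x → <⇒≱ bx<by (blockOf-mono ns y≤x)

crosses⇒fromLeft⊎fromRight : ∀ ns (π : Permutation′ (sum ns)) {a b} → Crosses ns π a b →
  CrossesFromLeft ns π a b ⊎ CrossesFromRight ns π a b
crosses⇒fromLeft⊎fromRight ns π {a} {b} a×b
  rewrite [+m]-[+n]≡m⊖n (toℕ a) (toℕ b) | [+m]-[+n]≡m⊖n (toℕ (π ⟨$⟩ʳ a)) (toℕ (π ⟨$⟩ʳ b))
  with i*j<0⇒[i<0×0<j]⊎[0<i×j<0] _ _ a×b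
... | inj₁ (a<b , πb<πa) = inj₁ (m⊖n<0⇒m<n a<b , 0<m⊖n⇒n<m πb<πa)
... | inj₂ (b<a , πa<πb) = inj₂ (0<m⊖n⇒n<m b<a , m⊖n<0⇒m<n πa<πb)

module _ (ns : List ℕ) (π : Permutation′ (sum ns)) (S : Fin (sum ns) → Bool) where

  private
    Edge : Set
    Edge = Fin (sum ns)

    variable
      e i u : Edge
      p q : Edge → Bool

  lower : Edge → ℕ
  lower u = toℕ (π ⟨$⟩ʳ u)

  markedCount : (Edge → Bool) → ℕ
  markedCount p = count (λ u → p u ∧ S u)

  markedBelow : (Edge → ℕ) → ℕ → ℕ
  markedBelow f x = markedCount (λ u → f u <ᵇ x)

  upperCount lowerCount : Edge → ℕ
  upperCount e = markedBelow toℕ (toℕ e)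
  lowerCount e = markedBelow lower (lower e)

  bdiff≡lowerCount⊖upperCount : ∀ e → bdiff ns π S e ≡ lowerCount e ⊖ upperCount e
  bdiff≡lowerCount⊖upperCount e = begin
    bdiff ns π S e                          ≡⟨ [+m]-[+n]≡m⊖n (suc lowerCount′) (suc (upperCount e)) ⟩
    suc lowerCount′ ⊖ suc (upperCount e)    ≡⟨ [1+m]⊖[1+n]≡m⊖n lowerCount′ (upperCount e) ⟩
    lowerCount′ ⊖ upperCount e              ≡⟨ cong (_⊖ upperCount e) lowerCount′≡lowerCount ⟩
    lowerCount e ⊖ upperCount e             ∎
    where
    open ≡-Reasoning
    lowerCount′ : ℕ
    lowerCount′ = count (λ v → (toℕ v <ᵇ lower e) ∧ S (π ⟨$⟩ˡ v))
    lowerCount′≡lowerCount : lowerCount′ ≡ lowerCount e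
    lowerCount′≡lowerCount = trans (count-permute π _)
      (count-cong λ u → cong (λ w → (lower u <ᵇ lower e) ∧ S w) (inverseˡ π))

  markedCount-mono : (∀ u → T (p u) → T (q u)) → markedCount p ≤ markedCount q
  markedCount-mono p⇒q = count-mono λ u → from T-∧ ∘ map₁ (p⇒q u) ∘ to T-∧

  markedCount-mono-< : (∀ u → T (p u) → T (q u)) → ∀ k → ¬ T (p k) → T (q k) → T (S k) →
                       markedCount p < markedCount q
  markedCount-mono-< p⇒q k ¬pk qk Sk =
    count-mono-< (λ u → from T-∧ ∘ map₁ (p⇒q u) ∘ to T-∧) k (¬pk ∘ proj₁ ∘ to T-∧) (from T-∧ (qk , Sk))

  markedBelow-mono : ∀ f {x y} → x ≤ y → markedBelow f x ≤ markedBelow f y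
  markedBelow-mono f x≤y =
    markedCount-mono λ u fu<x → <⇒<ᵇ (<-≤-trans (<ᵇ⇒< _ _ fu<x) x≤y)

  homogeneous? : ∀ u → Dec (Homogeneous ns π u)
  homogeneous? u = blockOf ns (toℕ u) ≟ℕ blockOf ns (lower u)

  unmarked⇒homogeneous : IsMarking ns π S → S u ≡ false → Homogeneous ns π u
  unmarked⇒homogeneous {u} marking unmarked =
    decidable-stable (homogeneous? u)
      λ inhomogeneous → contradiction (trans (sym unmarked) (marking u inhomogeneous)) λ ()

  markedBelow-blockOf-upper≡lower : IsMarking ns π S → ∀ r →
    markedBelow (blockOf ns ∘ toℕ) r ≡ markedBelow (blockOf ns ∘ lower) r
  markedBelow-blockOf-upper≡lower marking r =
    +-cancelʳ-≡ (count (λ u → starts u ∧ not (S u))) _ _ (begin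
      markedCount starts + count (λ u → starts u ∧ not (S u))   ≡⟨ count-split starts S ⟨
      count starts                                              ≡⟨ count-permute π starts ⟩
      count ends                                                ≡⟨ count-split ends S ⟩
      markedCount ends + count (λ u → ends u ∧ not (S u))       ≡⟨ cong₂ _+_ refl (count-cong unmarked-agree) ⟨
      markedCount ends + count (λ u → starts u ∧ not (S u))     ∎)
    where
    open ≡-Reasoning
    starts ends : Edge → Bool
    starts u = blockOf ns (toℕ u) <ᵇ r
    ends u = blockOf ns (lower u) <ᵇ r
    unmarked-agree : ∀ u → starts u ∧ not (S u) ≡ ends u ∧ not (S u)
    unmarked-agree u with S u in Su
    ... | true  = trans (∧-zeroʳ (starts u)) (sym (∧-zeroʳ (ends u)))
    ... | false = cong (λ β → (β <ᵇ r) ∧ true) (unmarked⇒homogeneous marking Su)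

  upperCount-mono-< : toℕ i < toℕ e → T (S i) → upperCount i < upperCount e
  upperCount-mono-< {i} i<e Si =
    markedCount-mono-< (λ u u<i → <⇒<ᵇ (<-trans (<ᵇ⇒< _ _ u<i) i<e)) i
                       (<-irrefl refl ∘ <ᵇ⇒< (toℕ i) (toℕ i)) (<⇒<ᵇ i<e) Si

  bdiff<0⇒lowerCount<upperCount : bdiff ns π S e ℤ.< + 0 → lowerCount e < upperCount e
  bdiff<0⇒lowerCount<upperCount {e} neg =
    m⊖n<0⇒m<n (subst (ℤ._< + 0) (bdiff≡lowerCount⊖upperCount e) neg)

  right-crosser-bdiff≤-1 : bdiff ns π S i ℤ.< + 0 → CrossesFromRight ns π e i →
                           bdiff ns π S e ℤ.≤ -[1+ 0 ]
  right-crosser-bdiff≤-1 {i} {e} neg-i (i<e , πe<πi) =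
    subst (ℤ._≤ -[1+ 0 ]) (sym (bdiff≡lowerCount⊖upperCount e)) (m<n⇒m⊖n≤-1 (begin-strict
      lowerCount e   ≤⟨ markedBelow-mono lower (<⇒≤ πe<πi) ⟩
      lowerCount i   <⟨ bdiff<0⇒lowerCount<upperCount neg-i ⟩
      upperCount i   ≤⟨ markedBelow-mono toℕ (<⇒≤ i<e) ⟩
      upperCount e   ∎))
    where open ≤-Reasoning

  right-crosser-bdiff<-1 : bdiff ns π S i ℤ.< + 0 → T (S i) → CrossesFromRight ns π e i →
                           bdiff ns π S e ℤ.< -[1+ 0 ]
  right-crosser-bdiff<-1 {i} {e} neg-i Si (i<e , πe<πi) =
    subst (ℤ._< -[1+ 0 ]) (sym (bdiff≡lowerCount⊖upperCount e)) (1+m<n⇒m⊖n<-1 (begin-strict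
      suc (lowerCount e)   ≤⟨ s≤s (markedBelow-mono lower (<⇒≤ πe<πi)) ⟩
      suc (lowerCount i)   ≤⟨ bdiff<0⇒lowerCount<upperCount neg-i ⟩
      upperCount i         <⟨ upperCount-mono-< i<e Si ⟩
      upperCount e         ∎))
    where open ≤-Reasoning

  inhomogeneous-left-crosser-bdiff>0 : IsMarking ns π S → Homogeneous ns π i → CrossesFromLeft ns π e i →
                                       ¬ Homogeneous ns π e → + 0 ℤ.< bdiff ns π S e
  inhomogeneous-left-crosser-bdiff>0 {i} {e} marking hom-i (e<i , πi<πe) inhom-e =
    subst (+ 0 ℤ.<_) (sym (bdiff≡lowerCount⊖upperCount e)) (n<m⇒0<m⊖n (begin-strict
      upperCount e                         <⟨ markedCount-mono-< below-e⇒below-r e (<-irrefl refl ∘ <ᵇ⇒< (toℕ e) (toℕ e))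
                                                (<⇒<ᵇ block-e<r) (from T-≡ (marking e inhom-e)) ⟩
      markedBelow (blockOf ns ∘ toℕ) r     ≡⟨ markedBelow-blockOf-upper≡lower marking r ⟩
      markedBelow (blockOf ns ∘ lower) r   ≤⟨ markedCount-mono (λ u → <⇒<ᵇ ∘ blockOf-cancel-< ns ∘ <ᵇ⇒< _ _) ⟩
      lowerCount e                         ∎))
    where
    open ≤-Reasoning
    r : ℕ
    r = blockOf ns (lower e)
    block-e<r : blockOf ns (toℕ e) < r
    block-e<r = ≤∧≢⇒< (begin
      blockOf ns (toℕ e)   ≤⟨ blockOf-mono ns (<⇒≤ e<i) ⟩
      blockOf ns (toℕ i)   ≡⟨ hom-i ⟩
      blockOf ns (lower i) ≤⟨ blockOf-mono ns (<⇒≤ πi<πe) ⟩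
      r                    ∎) inhom-e
    below-e⇒below-r : ∀ u → T (toℕ u <ᵇ toℕ e) → T (blockOf ns (toℕ u) <ᵇ r)
    below-e⇒below-r u u<e = <⇒<ᵇ (≤-<-trans (blockOf-mono ns (<⇒≤ (<ᵇ⇒< _ _ u<e))) block-e<r)

  IsLeftmostNegative : Edge → Set
  IsLeftmostNegative i = ∀ j → Homogeneous ns π j → bdiff ns π S j ℤ.< + 0 → toℕ i ≤ toℕ j

  ZeroCrosser : Edge → Edge → Set
  ZeroCrosser i j = (toℕ j < toℕ i) × Homogeneous ns π j × (bdiff ns π S j ≡ + 0) × Crosses ns π j i

  zeroCrosser? : ∀ i j → Dec (ZeroCrosser i j)
  zeroCrosser? i j = (toℕ j <? toℕ i) ×-dec homogeneous? j ×-dec (bdiff ns π S j ℤ.≟ + 0) ×-dec (_ ℤ.<? _)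

  left-crosser-bdiff≥0 : IsMarking ns π S → Homogeneous ns π i → IsLeftmostNegative i →
                         CrossesFromLeft ns π e i → + 0 ℤ.≤ bdiff ns π S e
  left-crosser-bdiff≥0 {i} {e} marking hom-i leftmost left@(e<i , _) with homogeneous? e
  ... | yes hom-e  = ℤ.≮⇒≥ λ neg-e → <⇒≱ e<i (leftmost e hom-e neg-e)
  ... | no inhom-e = ℤ.<⇒≤ (inhomogeneous-left-crosser-bdiff>0 marking hom-i left inhom-e)

  module _ (marking : IsMarking ns π S) {i : Edge} (hom-i : Homogeneous ns π i)
           (neg-i : bdiff ns π S i ℤ.< + 0) (leftmost : IsLeftmostNegative i) where

    unmarked-convCond : ConvCond ns π S false i
    unmarked-convCond e e×i with crosses⇒fromLeft⊎fromRight ns π e×i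
    ... | inj₁ left  = inj₁ (left , left-crosser-bdiff≥0 marking hom-i leftmost left)
    ... | inj₂ right = inj₂ (right , right-crosser-bdiff≤-1 neg-i right)

    marked-convCond : T (S i) → ¬ ∃ (ZeroCrosser i) → ConvCond ns π S true i
    marked-convCond Si noZeroCrosser e e×i with crosses⇒fromLeft⊎fromRight ns π e×i
    ... | inj₂ right = inj₂ (right , right-crosser-bdiff<-1 neg-i Si right)
    ... | inj₁ left@(e<i , _) = inj₁ (left , ℤ.≤∧≢⇒< (left-crosser-bdiff≥0 marking hom-i leftmost left) nonzero)
      where
      nonzero : + 0 ≢ bdiff ns π S e
      nonzero 0≡bdiff with homogeneous? e
      ... | yes hom-e  = noZeroCrosser (e , e<i , hom-e , sym 0≡bdiff , e×i)
      ... | no inhom-e = ℤ.<-irrefl 0≡bdiff (inhomogeneous-left-crosser-bdiff>0 marking hom-i left inhom-e)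

    convertible : ¬ ∃ (ZeroCrosser i) → Convertible ns π S i
    convertible noZeroCrosser = hom-i , convCond (S i) refl
      where
      convCond : ∀ b → S i ≡ b → ConvCond ns π S b i
      convCond false _        = unmarked-convCond
      convCond true  marked-i = marked-convCond (from T-≡ marked-i) noZeroCrosser

lemma4p3 : (ns : List ℕ) → All (λ n → 0 < n) ns →
    (π : Permutation′ (sum ns)) → (S : Fin (sum ns) → Bool) → IsMarking ns π S →
    ∃ (λ h → Homogeneous ns π h) →
    (i : Fin (sum ns)) → Homogeneous ns π i → bdiff ns π S i ℤ.< + 0 →
    (∀ j → Homogeneous ns π j → bdiff ns π S j ℤ.< + 0 → toℕ i ≤ toℕ j) →
    ¬ Convertible ns π S i →
    ∃ (λ j → (toℕ j < toℕ i) × Homogeneous ns π j × (bdiff ns π S j ≡ + 0) × Crosses ns π j i)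
lemma4p3 ns _ π S marking _ i hom-i neg-i leftmost nonconvertible with any? (zeroCrosser? ns π S i)
... | yes zeroCrosser  = zeroCrosser
... | no noZeroCrosser = contradiction (convertible ns π S marking hom-i neg-i leftmost noZeroCrosser) nonconvertible
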